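{- Let $f,n\in\mathbb{N}$ and consider the unidirectional flow-firing configuration with sequence of flow $\operatorname{flow}(k)=f$ for $0\le k<n$ and $\operatorname{flow}(k)=0$ for $k\ge n$. Then the flow-firing process starting from it stabilizes (every maximal sequence of firing moves is finite and ends in the same stable configuration), and the stable configuration has a weakly decreasing sequence of flow in which, disregarding consecutive pairs of faces that both still have flow $f$ (and the pairs of faces with flow $0$ at the end), at most one pair of consecutive faces have the same flow, and all other consecutive pairs of faces have flows differing by exactly $1$. (For example, $6,6,6,6,6,0,0,\dots$ stabilizes to $6,6,5,4,3,3,2,1,0,0,\dots$.)
   Context: Flow-firing in face representation: a configuration assigns an integer value $\operatorname{flow}(F)$ to each face $F$ of a planar graph. A firing move chooses two faces $F,G$ sharing an edge with $\operatorname{flow}(F)-\operatorname{flow}(G)\ge 2$ and replaces $\operatorname{flow}(F)$ by $\operatorname{flow}(F)-1$ and $\operatorname{flow}(G)$ by $\operatorname{flow}(G)+1$. A configuration is stable if no firing move is possible. A unidirectional flow-firing configuration is such a configuration on the planar graph isomorphic to the $\mathbb{N}$ lattice: a one-dimensional strip of square faces indexed by $0,1,2,\dots$, where faces $i$ and $j$ share an edge iff $|i-j|=1$. Its sequence of flow is $(\operatorname{flow}(0),\operatorname{flow}(1),\dots)$. -}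

module Defs where

open import Data.Nat using (ℕ; zero; suc; _<ᵇ_; _≡ᵇ_)
open import Data.Integer using (ℤ; +_; _-_; _+_; _≤_; _<_)
open import Data.Bool using (if_then_else_)
open import Data.Product using (Σ; ∃; _×_; _,_)
open import Data.Sum using (_⊎_)
open import Relation.Nullary using (¬_)
open import Relation.Binary.PropositionalEquality using (_≡_)

Config : Set
Config = ℕ → ℤ

Adjacent : ℕ → ℕ → Set
Adjacent i j = suc i ≡ j ⊎ suc j ≡ i

moveFlow : Config → ℕ → ℕ → Config
moveFlow c i j k =
  if k ≡ᵇ i then c i - + 1 else (if k ≡ᵇ j then c j + + 1 else c k)

Fire : Config → Config → Set
Fire c d = Σ ℕ λ i → Σ ℕ λ j →
  Adjacent i j × (+ 2 ≤ c i - c j) × (∀ k → d k ≡ moveFlow c i j k)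

Stable : Config → Set
Stable c = ∀ i j → Adjacent i j → ¬ (+ 2 ≤ c i - c j)

initial : ℕ → ℕ → Config
initial f n k = if k <ᵇ n then + f else + 0

Disregarded : ℕ → Config → ℕ → Set
Disregarded f s k = (s k ≡ + f × s (suc k) ≡ + f) ⊎ (s k ≡ + 0 × s (suc k) ≡ + 0)

Shape : ℕ → Config → Set
Shape f s =
  (∀ k → s (suc k) ≤ s k)
  × (∀ k → Disregarded f s k ⊎ s k ≡ s (suc k) ⊎ s k ≡ s (suc k) + + 1)
  × (∀ j k → ¬ Disregarded f s j → s j ≡ s (suc j)
           → ¬ Disregarded f s k → s k ≡ s (suc k) → j ≡ k)

module Submission where

-- Write prefix c m for the total flow on faces 0, …, m − 1. In a weakly decreasing nonnegative
-- configuration a firing can only move a unit from a face i to i + 1; this keeps the configuration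
-- decreasing and nonnegative, lowers prefix c (i + 1) by one and fixes every other prefix sum.
-- A fireable face i carries flow at least 1 on all faces ≤ i, so i < n·f, and the sum of the
-- prefix sums up to n·f drops by one with every firing: the process terminates.
--
-- Comparison principle: if s k − s (k + 1) ≤ 1 for all k and the prefix sums of s are below
-- those of c, this persists through every firing from c, because equality at i + 1 would make
-- s fireable at i as well. For two reachable stable configurations this gives equal prefix
-- sums, hence uniqueness. If the stable configuration t had two flat, non-disregarded pairs
-- j < k, moving a unit from face k + 1 to face j would produce such an s below the initial
-- configuration whose prefix sum at j + 1 exceeds that of t.

open import Defs
open import Data.Bool using (true; false; if_then_else_)
open import Data.Empty using (⊥; ⊥-elim)
open import Data.Integer as ℤ using (ℤ; +_; 0ℤ; _+_; _-_; -_; _≤_; _<_; +≤+)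
import Data.Integer.Properties as ℤₚ
open import Algebra.Properties.AbelianGroup ℤₚ.+-0-abelianGroup using (xyx⁻¹≈y)
open import Algebra.Properties.CommutativeSemigroup ℤₚ.+-commutativeSemigroup using (interchange)
open import Data.Integer.Tactic.RingSolver using (solve)
open import Data.List using (_∷_; [])
open import Data.Nat as ℕ using (ℕ; zero; suc; _≡ᵇ_; _<ᵇ_; _*_; z≤n; s≤s)
import Data.Nat.Properties as ℕₚ
open import Data.Product using (Σ; ∃; _×_; _,_; proj₂)
open import Data.Sum using (_⊎_; inj₁; inj₂)
open import Function using (flip; _∘_)
open import Induction.WellFounded using (Acc; acc)
open import Relation.Binary.Construct.Closure.ReflexiveTransitive using (Star; ε; _◅_)
open import Relation.Binary.Definitions using (tri<; tri≈; tri>)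
open import Relation.Binary.PropositionalEquality
open import Relation.Nullary using (¬_; yes; no)
open import Relation.Nullary.Decidable using (dec-true; dec-false)

+-cancelˡ-≤ : ∀ x {y z} → x + y ≤ x + z → y ≤ z
+-cancelˡ-≤ x {y} {z} x+y≤x+z = begin
  y               ≡⟨ solve (x ∷ y ∷ []) ⟩
  - x + (x + y)   ≤⟨ ℤₚ.+-monoʳ-≤ (- x) x+y≤x+z ⟩
  - x + (x + z)   ≡⟨ solve (x ∷ z ∷ []) ⟩
  z               ∎
  where open ℤₚ.≤-Reasoning

≤-minus⇒+-≤ : ∀ {a b x} → x ≤ a - b → b + x ≤ a
≤-minus⇒+-≤ {a} {b} {x} x≤a-b = begin
  b + x         ≤⟨ ℤₚ.+-monoʳ-≤ b x≤a-b ⟩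
  b + (a - b)   ≡⟨ solve (a ∷ b ∷ []) ⟩
  a             ∎
  where open ℤₚ.≤-Reasoning

minus-≤⇒≤-+ : ∀ {a b x} → a - b ≤ x → a ≤ b + x
minus-≤⇒≤-+ {a} {b} {x} a-b≤x = begin
  a             ≡⟨ solve (a ∷ b ∷ []) ⟩
  b + (a - b)   ≤⟨ ℤₚ.+-monoʳ-≤ b a-b≤x ⟩
  b + x         ∎
  where open ℤₚ.≤-Reasoning

minus-mono-≤ : ∀ {a a′ b b′} → a ≤ a′ → b′ ≤ b → a - b ≤ a′ - b′
minus-mono-≤ a≤a′ b′≤b = ℤₚ.+-mono-≤ a≤a′ (ℤₚ.neg-mono-≤ b′≤b)

<⇒+1≤ : ∀ {x y} → x < y → x + + 1 ≤ y
<⇒+1≤ {x} x<y = subst (_≤ _) (ℤₚ.+-comm (+ 1) x) (ℤₚ.i<j⇒suc[i]≤j x<y)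

2≤i-j⇒j+1≤i-1 : ∀ i j → + 2 ≤ i - j → j + + 1 ≤ i - + 1
2≤i-j⇒j+1≤i-1 i j 2≤i-j = begin
  j + + 1           ≡⟨ solve (j ∷ []) ⟩
  j + + 2 - + 1     ≤⟨ ℤₚ.+-monoˡ-≤ (- + 1) (≤-minus⇒+-≤ {i} {j} 2≤i-j) ⟩
  i - + 1           ∎
  where open ℤₚ.≤-Reasoning

≡ᵇ-refl : ∀ m → (m ≡ᵇ m) ≡ true
≡ᵇ-refl m = dec-true (m ℕ.≟ m) refl

≢⇒≡ᵇ-false : ∀ {m k} → m ≢ k → (m ≡ᵇ k) ≡ false
≢⇒≡ᵇ-false {m} {k} = dec-false (m ℕ.≟ k)

<⇒<ᵇ-true : ∀ {m k} → m ℕ.< k → (m <ᵇ k) ≡ true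
<⇒<ᵇ-true {m} {k} = dec-true (m ℕ.<? k)

≥⇒<ᵇ-false : ∀ {m k} → k ℕ.≤ m → (m <ᵇ k) ≡ false
≥⇒<ᵇ-false {m} {k} k≤m = dec-false (m ℕ.<? k) (ℕₚ.≤⇒≯ k≤m)

moveFlow-source : ∀ c i j → moveFlow c i j i ≡ c i - + 1
moveFlow-source c i j rewrite ≡ᵇ-refl i = refl

moveFlow-target : ∀ c {i j} → i ≢ j → moveFlow c i j j ≡ c j + + 1
moveFlow-target c {i} {j} i≢j rewrite ≢⇒≡ᵇ-false (i≢j ∘ sym) | ≡ᵇ-refl j = refl

moveFlow-other : ∀ c {i j k} → k ≢ i → k ≢ j → moveFlow c i j k ≡ c k
moveFlow-other c k≢i k≢j rewrite ≢⇒≡ᵇ-false k≢i | ≢⇒≡ᵇ-false k≢j = refl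

moveFlow-≤ : ∀ c {i j k} → k ≢ j → moveFlow c i j k ≤ c k
moveFlow-≤ c {i} {j} {k} k≢j with k ℕ.≟ i
... | yes refl = subst (_≤ c k) (sym (moveFlow-source c k j)) (ℤₚ.i-j≤i (c k) (+ 1))
... | no k≢i   = ℤₚ.≤-reflexive (moveFlow-other c k≢i k≢j)

moveFlow-≥ : ∀ c {i j k} → k ≢ i → c k ≤ moveFlow c i j k
moveFlow-≥ c {i} {j} {k} k≢i with k ℕ.≟ j
... | yes refl = subst (c k ≤_) (sym (moveFlow-target c (k≢i ∘ sym))) (ℤₚ.i≤i+j (c k) (+ 1))
... | no k≢j   = ℤₚ.≤-reflexive (sym (moveFlow-other c k≢i k≢j))

unit : ℕ → Config
unit j k = if k ≡ᵇ j then + 1 else 0ℤ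

unit-self : ∀ j → unit j j ≡ + 1
unit-self j rewrite ≡ᵇ-refl j = refl

unit-≢ : ∀ {j k} → k ≢ j → unit j k ≡ 0ℤ
unit-≢ k≢j rewrite ≢⇒≡ᵇ-false k≢j = refl

unit-nonNegative : ∀ j k → 0ℤ ≤ unit j k
unit-nonNegative j k with k ≡ᵇ j
... | true  = +≤+ z≤n
... | false = +≤+ z≤n

moveFlow-unit : ∀ c {i j} → i ≢ j → ∀ k → moveFlow c i j k ≡ c k + unit j k - unit i k
moveFlow-unit c {i} {j} i≢j k with k ℕ.≟ i | k ℕ.≟ j
... | yes refl | _
  rewrite moveFlow-source c k j | unit-≢ i≢j | unit-self k
  = cong (_- + 1) (sym (ℤₚ.+-identityʳ (c k)))
... | no k≢i | yes refl
  rewrite moveFlow-target c i≢j | unit-self k | unit-≢ k≢i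
  = sym (ℤₚ.+-identityʳ (c k + + 1))
... | no k≢i | no k≢j
  rewrite moveFlow-other c k≢i k≢j | unit-≢ k≢i | unit-≢ k≢j
  = sym (trans (ℤₚ.+-identityʳ (c k + 0ℤ)) (ℤₚ.+-identityʳ (c k)))

NonNegative : Config → Set
NonNegative c = ∀ k → 0ℤ ≤ c k

Decreasing : Config → Set
Decreasing c = ∀ k → c (suc k) ≤ c k

record Admissible (c : Config) : Set where
  field
    decreasing  : Decreasing c
    nonNegative : NonNegative c

open Admissible

decreasing-≤ : ∀ {c r k} → Decreasing c → r ℕ.≤ k → c k ≤ c r
decreasing-≤ {c} {r} dec r≤k = go (ℕₚ.≤⇒≤′ r≤k)
  where
  go : ∀ {k} → r ℕ.≤′ k → c k ≤ c r
  go ℕ.≤′-refl       = ℤₚ.≤-refl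
  go (ℕ.≤′-step r≤k) = ℤₚ.≤-trans (dec _) (go r≤k)

-- Prefix sums

prefix : Config → ℕ → ℤ
prefix c zero    = 0ℤ
prefix c (suc m) = prefix c m + c m

prefix-cong : ∀ {c d} → (∀ k → c k ≡ d k) → ∀ m → prefix c m ≡ prefix d m
prefix-cong c≗d zero    = refl
prefix-cong c≗d (suc m) = cong₂ _+_ (prefix-cong c≗d m) (c≗d m)

prefix-+ : ∀ c d m → prefix (λ k → c k + d k) m ≡ prefix c m + prefix d m
prefix-+ c d zero    = refl
prefix-+ c d (suc m) = begin
  prefix (λ k → c k + d k) m + (c m + d m)   ≡⟨ cong (_+ (c m + d m)) (prefix-+ c d m) ⟩
  prefix c m + prefix d m + (c m + d m)      ≡⟨ interchange (prefix c m) (prefix d m) (c m) (d m) ⟩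
  prefix c m + c m + (prefix d m + d m)      ∎
  where open ≡-Reasoning

prefix-neg : ∀ c m → prefix (λ k → - c k) m ≡ - prefix c m
prefix-neg c zero    = refl
prefix-neg c (suc m) =
  trans (cong (_- c m) (prefix-neg c m)) (sym (ℤₚ.neg-distrib-+ (prefix c m) (c m)))

prefix-injective : ∀ {c d} → (∀ m → prefix c m ≡ prefix d m) → ∀ k → c k ≡ d k
prefix-injective {c} {d} c≗d k = begin
  c k                                ≡⟨ xyx⁻¹≈y (prefix c k) (c k) ⟨
  prefix c (suc k) - prefix c k      ≡⟨ cong₂ _-_ (c≗d (suc k)) (c≗d k) ⟩
  prefix d (suc k) - prefix d k      ≡⟨ xyx⁻¹≈y (prefix d k) (d k) ⟩
  d k                                ∎
  where open ≡-Reasoning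

prefix-monoʳ-≤ : ∀ {c m m′} → NonNegative c → m ℕ.≤ m′ → prefix c m ≤ prefix c m′
prefix-monoʳ-≤ {c} {m} c≥0 m≤m′ = go (ℕₚ.≤⇒≤′ m≤m′)
  where
  go : ∀ {m′} → m ℕ.≤′ m′ → prefix c m ≤ prefix c m′
  go ℕ.≤′-refl       = ℤₚ.≤-refl
  go (ℕ.≤′-step m≤m′) =
    ℤₚ.≤-trans (go m≤m′) (ℤₚ.i≤i+j _ _ {{ℤ.nonNegative (c≥0 _)}})

prefix-nonNegative : ∀ {c} → NonNegative c → NonNegative (prefix c)
prefix-nonNegative c≥0 m = prefix-monoʳ-≤ {m′ = m} c≥0 z≤n

prefix-mono-≤ : ∀ {c d} m → (∀ r → r ℕ.< m → c r ≤ d r) → prefix c m ≤ prefix d m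
prefix-mono-≤ zero    c≤d = ℤₚ.≤-refl
prefix-mono-≤ (suc m) c≤d =
  ℤₚ.+-mono-≤ (prefix-mono-≤ m (λ r → c≤d r ∘ ℕₚ.m<n⇒m<1+n)) (c≤d m ℕₚ.≤-refl)

prefix-mono-< : ∀ {c d j} m → j ℕ.< m → (∀ r → r ℕ.< m → c r ≤ d r) → c j < d j →
                prefix c m < prefix d m
prefix-mono-< {j = j} (suc m) j<1+m c≤d cj<dj with ℕₚ.m≤n⇒m<n∨m≡n (ℕ.s≤s⁻¹ j<1+m)
... | inj₁ j<m =
  ℤₚ.+-mono-<-≤ (prefix-mono-< m j<m (λ r → c≤d r ∘ ℕₚ.m<n⇒m<1+n) cj<dj) (c≤d m ℕₚ.≤-refl)
... | inj₂ refl =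
  ℤₚ.+-mono-≤-< (prefix-mono-≤ m (λ r → c≤d r ∘ ℕₚ.m<n⇒m<1+n)) cj<dj

length-≤-prefix : ∀ {c} m → (∀ r → r ℕ.< m → + 1 ≤ c r) → + m ≤ prefix c m
length-≤-prefix zero    _   = ℤₚ.≤-refl
length-≤-prefix {c} (suc m) 1≤c = begin
  + suc m            ≡⟨ ℤₚ.+-comm (+ 1) (+ m) ⟩
  + m + + 1          ≤⟨ ℤₚ.+-mono-≤ (length-≤-prefix m (λ r → 1≤c r ∘ ℕₚ.m<n⇒m<1+n)) (1≤c m ℕₚ.≤-refl) ⟩
  prefix c (suc m)   ∎
  where open ℤₚ.≤-Reasoning

prefix-unit-≤ : ∀ {j m} → m ℕ.≤ j → prefix (unit j) m ≡ 0ℤ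
prefix-unit-≤ {m = zero}  _   = refl
prefix-unit-≤ {m = suc m} m<j rewrite prefix-unit-≤ (ℕₚ.<⇒≤ m<j) | unit-≢ (ℕₚ.<⇒≢ m<j) = refl

prefix-unit-> : ∀ {j m} → j ℕ.< m → prefix (unit j) m ≡ + 1
prefix-unit-> {j} {suc m} j<1+m with ℕₚ.m≤n⇒m<n∨m≡n (ℕ.s≤s⁻¹ j<1+m)
... | inj₁ j<m  rewrite prefix-unit-> j<m | unit-≢ (ℕₚ.>⇒≢ j<m) = refl
... | inj₂ refl rewrite prefix-unit-≤ (ℕₚ.≤-refl {j}) | unit-self j = refl

prefix-unit-suc : ∀ i m → prefix (unit (suc i)) (suc m) ≡ prefix (unit i) m
prefix-unit-suc i zero    = refl
prefix-unit-suc i (suc m) = cong (_+ unit i m) (prefix-unit-suc i m)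

prefix-moveFlow : ∀ c {i j} → i ≢ j → ∀ m →
                  prefix (moveFlow c i j) m ≡ prefix c m + prefix (unit j) m - prefix (unit i) m
prefix-moveFlow c {i} {j} i≢j m = begin
  prefix (moveFlow c i j) m                                         ≡⟨ prefix-cong (moveFlow-unit c i≢j) m ⟩
  prefix (λ k → c k + unit j k - unit i k) m                        ≡⟨ prefix-+ (λ k → c k + unit j k) (λ k → - unit i k) m ⟩
  prefix (λ k → c k + unit j k) m + prefix (λ k → - unit i k) m     ≡⟨ cong₂ _+_ (prefix-+ c (unit j) m) (prefix-neg (unit i) m) ⟩
  prefix c m + prefix (unit j) m - prefix (unit i) m                ∎
  where open ≡-Reasoning

-- Firing from decreasing configurations

Fireable : Config → ℕ → Set
Fireable c i = + 2 ≤ c i - c (suc i)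

RightStable : Config → Set
RightStable c = ∀ i → ¬ Fireable c i

record RightFiring (c : Config) (i : ℕ) (d : Config) : Set where
  constructor rightFiring
  field
    fireable : Fireable c i
    result   : ∀ k → d k ≡ moveFlow c i (suc i) k

open RightFiring

_≼_ : Config → Config → Set
s ≼ c = ∀ m → prefix s m ≤ prefix c m

Bounded : ℕ → Config → Set
Bounded B c = ∀ m → prefix c m ≤ + B

≼-bounded : ∀ {B c d} → d ≼ c → Bounded B c → Bounded B d
≼-bounded d≼c bounded m = ℤₚ.≤-trans (d≼c m) (bounded m)

difference-one-¬fireable : ∀ {c i} → c i - c (suc i) ≡ + 1 → ¬ Fireable c i
difference-one-¬fireable c[i]-c[1+i]≡1 fire with subst (+ 2 ≤_) c[i]-c[1+i]≡1 fire
... | +≤+ (s≤s ())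

stable⇒rightStable : ∀ {c} → Stable c → RightStable c
stable⇒rightStable stable i = stable i (suc i) (inj₁ refl)

decreasing-¬fire-left : ∀ {c} → Decreasing c → ∀ j → ¬ (+ 2 ≤ c (suc j) - c j)
decreasing-¬fire-left dec j fire with ℤₚ.≤-trans fire (ℤₚ.i≤j⇒i-j≤0 (dec j))
... | +≤+ ()

rightStable⇒stable : ∀ {c} → Decreasing c → RightStable c → Stable c
rightStable⇒stable dec rs i        .(suc i) (inj₁ refl) = rs i
rightStable⇒stable dec rs .(suc j) j        (inj₂ refl) = decreasing-¬fire-left dec j

fire-rightward : ∀ {c d} → Decreasing c → Fire c d → ∃ λ i → RightFiring c i d
fire-rightward dec (i , .(suc i) , inj₁ refl , fire , d≗) = i , rightFiring fire d≗
fire-rightward dec (.(suc j) , j , inj₂ refl , fire , _)  = ⊥-elim (decreasing-¬fire-left dec j fire)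

rightFiring⇒fire : ∀ {c i d} → RightFiring c i d → Fire c d
rightFiring⇒fire {i = i} (rightFiring fire d≗) = i , suc i , inj₁ refl , fire , d≗

module _ {c i d} (firing : RightFiring c i d) where

  private
    i≢1+i : i ≢ suc i
    i≢1+i = ℕₚ.1+n≢n ∘ sym

  rightFiring-source : d i ≡ c i - + 1
  rightFiring-source = trans (firing .result i) (moveFlow-source c i (suc i))

  rightFiring-target : d (suc i) ≡ c (suc i) + + 1
  rightFiring-target = trans (firing .result (suc i)) (moveFlow-target c i≢1+i)

  rightFiring-other : ∀ {k} → k ≢ i → k ≢ suc i → d k ≡ c k
  rightFiring-other {k} k≢i k≢1+i = trans (firing .result k) (moveFlow-other c k≢i k≢1+i)

  rightFiring-decreasing : Decreasing c → Decreasing d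
  rightFiring-decreasing dec k with k ℕ.≟ i | k ℕ.≟ suc i | suc k ℕ.≟ i
  ... | yes refl | _ | _
    rewrite rightFiring-target | rightFiring-source
    = 2≤i-j⇒j+1≤i-1 (c k) (c (suc k)) (firing .fireable)
  ... | no _ | yes refl | _
    rewrite rightFiring-target | rightFiring-other {suc (suc i)} (ℕₚ.>⇒≢ (ℕₚ.m<n⇒m<1+n (ℕₚ.n<1+n i))) ℕₚ.1+n≢n
    = ℤₚ.≤-trans (dec (suc i)) (ℤₚ.i≤i+j (c (suc i)) (+ 1))
  ... | no k≢i | no k≢1+i | yes refl
    rewrite rightFiring-source | rightFiring-other k≢i k≢1+i
    = ℤₚ.≤-trans (ℤₚ.i-j≤i (c (suc k)) (+ 1)) (dec k)
  ... | no k≢i | no k≢1+i | no 1+k≢i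
    rewrite rightFiring-other k≢i k≢1+i | rightFiring-other 1+k≢i (k≢i ∘ ℕₚ.suc-injective)
    = dec k

  rightFiring-nonNegative : NonNegative c → NonNegative d
  rightFiring-nonNegative c≥0 k with k ℕ.≟ i | k ℕ.≟ suc i
  ... | yes refl | _ rewrite rightFiring-source = begin
    0ℤ                ≤⟨ c≥0 (suc k) ⟩
    c (suc k)         ≤⟨ ℤₚ.i≤i+j (c (suc k)) (+ 1) ⟩
    c (suc k) + + 1   ≤⟨ 2≤i-j⇒j+1≤i-1 (c k) (c (suc k)) (firing .fireable) ⟩
    c k - + 1         ∎
    where open ℤₚ.≤-Reasoning
  ... | no _ | yes refl rewrite rightFiring-target =
    ℤₚ.≤-trans (c≥0 (suc i)) (ℤₚ.i≤i+j (c (suc i)) (+ 1))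
  ... | no k≢i | no k≢1+i rewrite rightFiring-other k≢i k≢1+i = c≥0 k

  rightFiring-admissible : Admissible c → Admissible d
  rightFiring-admissible adm = record
    { decreasing  = rightFiring-decreasing (adm .decreasing)
    ; nonNegative = rightFiring-nonNegative (adm .nonNegative)
    }

  prefix-rightFiring : ∀ m → prefix d m + unit (suc i) m ≡ prefix c m
  prefix-rightFiring m = begin
    prefix d m + u                                                ≡⟨ cong (_+ u) (prefix-cong (firing .result) m) ⟩
    prefix (moveFlow c i (suc i)) m + u                           ≡⟨ cong (_+ u) (prefix-moveFlow c i≢1+i m) ⟩
    prefix c m + prefix (unit (suc i)) m - prefix (unit i) m + u  ≡⟨ cong (λ x → prefix c m + a - x + u) (prefix-unit-suc i m) ⟨
    prefix c m + a - (a + u) + u                                  ≡⟨ cancel (prefix c m) a u ⟩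
    prefix c m                                                    ∎
    where
    open ≡-Reasoning
    u : ℤ
    u = unit (suc i) m
    a : ℤ
    a = prefix (unit (suc i)) m
    cancel : ∀ x a u → x + a - (a + u) + u ≡ x
    cancel x a u = solve (x ∷ a ∷ u ∷ [])

  rightFiring-≼ : d ≼ c
  rightFiring-≼ m = begin
    prefix d m                    ≤⟨ ℤₚ.i≤i+j _ _ {{ℤ.nonNegative (unit-nonNegative (suc i) m)}} ⟩
    prefix d m + unit (suc i) m   ≡⟨ prefix-rightFiring m ⟩
    prefix c m                    ∎
    where open ℤₚ.≤-Reasoning

fire-admissible : ∀ {c d} → Admissible c → Fire c d → Admissible d
fire-admissible adm fire = rightFiring-admissible (fire-rightward (adm .decreasing) fire .proj₂) adm

fire-≼ : ∀ {c d} → Admissible c → Fire c d → d ≼ c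
fire-≼ adm fire = rightFiring-≼ (fire-rightward (adm .decreasing) fire .proj₂)

reachable-admissible : ∀ {c t} → Admissible c → Star Fire c t → Admissible t
reachable-admissible adm ε              = adm
reachable-admissible adm (fire ◅ steps) = reachable-admissible (fire-admissible adm fire) steps

reachable-≼ : ∀ {c t} → Admissible c → Star Fire c t → t ≼ c
reachable-≼ adm ε              m = ℤₚ.≤-refl
reachable-≼ adm (fire ◅ steps) m = ℤₚ.≤-trans (reachable-≼ (fire-admissible adm fire) steps m) (fire-≼ adm fire m)

-- Comparison in the prefix-sum order

≼-tight : ∀ {s c i} → s ≼ c → prefix c (suc i) ≤ prefix s (suc i) →
          c i ≤ s i × s (suc i) ≤ c (suc i)
≼-tight {s} {c} {i} s≼c tight = +-cancelˡ-≤ (prefix s i) left , +-cancelˡ-≤ (prefix s (suc i)) right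
  where
  left : prefix s i + c i ≤ prefix s i + s i
  left = ℤₚ.≤-trans (ℤₚ.+-monoˡ-≤ (c i) (s≼c i)) tight
  right : prefix s (suc i) + s (suc i) ≤ prefix s (suc i) + c (suc i)
  right = ℤₚ.≤-trans (s≼c (suc (suc i))) (ℤₚ.+-monoˡ-≤ (c (suc i)) tight)

≼-rightFiring : ∀ {s c i d} → RightStable s → s ≼ c → RightFiring c i d → s ≼ d
≼-rightFiring {s} {c} {i} {d} s-stable s≼c firing m with m ℕ.≟ suc i
... | no m≢1+i = begin
  prefix s m                    ≤⟨ s≼c m ⟩
  prefix c m                    ≡⟨ prefix-rightFiring firing m ⟨
  prefix d m + unit (suc i) m   ≡⟨ cong (_+_ (prefix d m)) (unit-≢ m≢1+i) ⟩
  prefix d m + 0ℤ               ≡⟨ ℤₚ.+-identityʳ (prefix d m) ⟩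
  prefix d m                    ∎
  where open ℤₚ.≤-Reasoning
... | yes refl = +-cancelˡ-≤ (+ 1) (begin
  + 1 + prefix s (suc i)                    ≤⟨ ℤₚ.i<j⇒suc[i]≤j s<c ⟩
  prefix c (suc i)                          ≡⟨ prefix-rightFiring firing (suc i) ⟨
  prefix d (suc i) + unit (suc i) (suc i)   ≡⟨ cong (_+_ (prefix d (suc i))) (unit-self (suc i)) ⟩
  prefix d (suc i) + + 1                    ≡⟨ ℤₚ.+-comm (prefix d (suc i)) (+ 1) ⟩
  + 1 + prefix d (suc i)                    ∎)
  where
  open ℤₚ.≤-Reasoning
  s-fireable : prefix c (suc i) ≤ prefix s (suc i) → Fireable s i
  s-fireable tight with ≼-tight s≼c tight
  ... | ci≤si , si′≤ci′ = ℤₚ.≤-trans (firing .fireable) (minus-mono-≤ ci≤si si′≤ci′)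
  s<c : prefix s (suc i) < prefix c (suc i)
  s<c = ℤₚ.≤∧≢⇒< (s≼c (suc i)) (s-stable i ∘ s-fireable ∘ ℤₚ.≤-reflexive ∘ sym)

≼-reachable : ∀ {s c t} → RightStable s → s ≼ c → Admissible c → Star Fire c t → s ≼ t
≼-reachable s-stable s≼c adm ε              = s≼c
≼-reachable s-stable s≼c adm (fire ◅ steps) with fire-rightward (adm .decreasing) fire
... | _ , firing =
  ≼-reachable s-stable (≼-rightFiring s-stable s≼c firing) (rightFiring-admissible firing adm) steps

stable-unique : ∀ {c t₁ t₂} → Admissible c → Star Fire c t₁ → Stable t₁ → Star Fire c t₂ → Stable t₂ →
                ∀ k → t₁ k ≡ t₂ k
stable-unique {c} {t₁} {t₂} adm steps₁ stable₁ steps₂ stable₂ =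
  prefix-injective λ m → ℤₚ.≤-antisym (t₁≼t₂ m) (t₂≼t₁ m)
  where
  t₁≼t₂ : t₁ ≼ t₂
  t₁≼t₂ = ≼-reachable (stable⇒rightStable {t₁} stable₁) (reachable-≼ adm steps₁) adm steps₂
  t₂≼t₁ : t₂ ≼ t₁
  t₂≼t₁ = ≼-reachable (stable⇒rightStable {t₂} stable₂) (reachable-≼ adm steps₂) adm steps₁

prefix-leftMove-inside : ∀ {c i j m} → j ℕ.< m → m ℕ.≤ i → prefix (moveFlow c i j) m ≡ prefix c m + + 1
prefix-leftMove-inside {c} {i} {j} {m} j<m m≤i = begin
  prefix (moveFlow c i j) m                             ≡⟨ prefix-moveFlow c (ℕₚ.>⇒≢ (ℕₚ.<-≤-trans j<m m≤i)) m ⟩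
  prefix c m + prefix (unit j) m - prefix (unit i) m    ≡⟨ cong₂ (λ x y → prefix c m + x - y) (prefix-unit-> j<m) (prefix-unit-≤ m≤i) ⟩
  prefix c m + + 1 + 0ℤ                                 ≡⟨ ℤₚ.+-identityʳ (prefix c m + + 1) ⟩
  prefix c m + + 1                                      ∎
  where open ≡-Reasoning

prefix-leftMove-outside : ∀ {c i j m} → j ℕ.< i → m ℕ.≤ j ⊎ i ℕ.< m → prefix (moveFlow c i j) m ≡ prefix c m
prefix-leftMove-outside {c} {i} {j} {m} j<i outside = begin
  prefix (moveFlow c i j) m                             ≡⟨ prefix-moveFlow c (ℕₚ.>⇒≢ j<i) m ⟩
  prefix c m + prefix (unit j) m - prefix (unit i) m    ≡⟨ cong (λ x → prefix c m + x - prefix (unit i) m) (same-side outside) ⟩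
  prefix c m + prefix (unit i) m - prefix (unit i) m    ≡⟨ cancel (prefix c m) (prefix (unit i) m) ⟩
  prefix c m                                            ∎
  where
  open ≡-Reasoning
  same-side : m ℕ.≤ j ⊎ i ℕ.< m → prefix (unit j) m ≡ prefix (unit i) m
  same-side (inj₁ m≤j) = trans (prefix-unit-≤ m≤j) (sym (prefix-unit-≤ (ℕₚ.≤-trans m≤j (ℕₚ.<⇒≤ j<i))))
  same-side (inj₂ i<m) = trans (prefix-unit-> (ℕₚ.<-trans j<i i<m)) (sym (prefix-unit-> i<m))
  cancel : ∀ x a → x + a - a ≡ x
  cancel x a = solve (x ∷ a ∷ [])

leftMove-≼ : ∀ {t c i j} → j ℕ.< i → t ≼ c → (∀ m → j ℕ.< m → m ℕ.≤ i → prefix t m < prefix c m) →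
             moveFlow t i j ≼ c
leftMove-≼ {t} {c} {i} {j} j<i t≼c t<c m with m ℕ.≤? j | i ℕ.<? m
... | yes m≤j | _       = ℤₚ.≤-trans (ℤₚ.≤-reflexive (prefix-leftMove-outside j<i (inj₁ m≤j))) (t≼c m)
... | no _    | yes i<m = ℤₚ.≤-trans (ℤₚ.≤-reflexive (prefix-leftMove-outside j<i (inj₂ i<m))) (t≼c m)
... | no m≰j  | no i≮m  =
  ℤₚ.≤-trans (ℤₚ.≤-reflexive (prefix-leftMove-inside j<m m≤i)) (<⇒+1≤ (t<c m j<m m≤i))
  where
  j<m : j ℕ.< m
  j<m = ℕₚ.≰⇒> m≰j
  m≤i : m ℕ.≤ i
  m≤i = ℕₚ.≮⇒≥ i≮m

leftMove-rightStable : ∀ {t j k} → RightStable t → j ℕ.< k → t j ≡ t (suc j) → t k ≡ t (suc k) →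
                       RightStable (moveFlow t (suc k) j)
leftMove-rightStable {t} {j} {k} t-stable j<k flat-j flat-k m with m ℕ.≟ j | m ℕ.≟ k
... | yes refl | _ = difference-one-¬fireable {moveFlow t (suc k) j} {m} (begin
  moveFlow t (suc k) j m - moveFlow t (suc k) j (suc m)
    ≡⟨ cong₂ _-_ (moveFlow-target t 1+k≢m) (moveFlow-other t 1+m≢1+k ℕₚ.1+n≢n) ⟩
  t m + + 1 - t (suc m)                                   ≡⟨ cong (λ x → x + + 1 - t (suc m)) flat-j ⟩
  t (suc m) + + 1 - t (suc m)                             ≡⟨ cancel (t (suc m)) ⟩
  + 1                                                     ∎)
  where
  open ≡-Reasoning
  1+k≢m : suc k ≢ m
  1+k≢m = ℕₚ.>⇒≢ (ℕₚ.m<n⇒m<1+n j<k)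
  1+m≢1+k : suc m ≢ suc k
  1+m≢1+k = ℕₚ.<⇒≢ (s≤s j<k)
  cancel : ∀ x → x + + 1 - x ≡ + 1
  cancel x = solve (x ∷ [])
... | no m≢j | yes refl = difference-one-¬fireable {moveFlow t (suc k) j} {m} (begin
  moveFlow t (suc k) j m - moveFlow t (suc k) j (suc m)
    ≡⟨ cong₂ _-_ (moveFlow-other t (ℕₚ.1+n≢n ∘ sym) m≢j) (moveFlow-source t (suc m) j) ⟩
  t m - (t (suc m) - + 1)                                 ≡⟨ cong (λ x → x - (t (suc m) - + 1)) flat-k ⟩
  t (suc m) - (t (suc m) - + 1)                           ≡⟨ cancel (t (suc m)) ⟩
  + 1                                                     ∎)
  where
  open ≡-Reasoning
  cancel : ∀ x → x - (x - + 1) ≡ + 1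
  cancel x = solve (x ∷ [])
... | no m≢j | no m≢k =
  t-stable m ∘ λ fire →
    ℤₚ.≤-trans fire (minus-mono-≤ (moveFlow-≤ t m≢j) (moveFlow-≥ t (m≢k ∘ ℕₚ.suc-injective)))

-- Termination

fireable-< : ∀ {B c i} → Admissible c → Bounded B c → Fireable c i → i ℕ.< B
fireable-< {B} {c} {i} adm bounded fire = ℤₚ.drop‿+≤+ (begin
  + suc i
    ≤⟨ length-≤-prefix (suc i) (λ r r<1+i → ℤₚ.≤-trans 1≤ci (decreasing-≤ (adm .decreasing) (ℕ.s≤s⁻¹ r<1+i))) ⟩
  prefix c (suc i)   ≤⟨ bounded (suc i) ⟩
  + B                ∎)
  where
  open ℤₚ.≤-Reasoning
  1≤ci : + 1 ≤ c i
  1≤ci = begin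
    + 1               ≤⟨ ℤₚ.+-monoˡ-≤ (+ 1) (adm .nonNegative (suc i)) ⟩
    c (suc i) + + 1   ≤⟨ 2≤i-j⇒j+1≤i-1 (c i) (c (suc i)) fire ⟩
    c i - + 1         ≤⟨ ℤₚ.i-j≤i (c i) (+ 1) ⟩
    c i               ∎

potential : ℕ → Config → ℤ
potential B c = prefix (prefix c) (suc B)

potential-nonNegative : ∀ B {c} → NonNegative c → 0ℤ ≤ potential B c
potential-nonNegative B c≥0 = prefix-nonNegative (prefix-nonNegative c≥0) (suc B)

potential-rightFiring : ∀ {B c i d} → RightFiring c i d → i ℕ.< B → + 1 + potential B d ≡ potential B c
potential-rightFiring {B} {c} {i} {d} firing i<B = begin
  + 1 + potential B d                                               ≡⟨ ℤₚ.+-comm (+ 1) (potential B d) ⟩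
  potential B d + + 1                                               ≡⟨ cong (_+_ (potential B d)) (prefix-unit-> (s≤s i<B)) ⟨
  prefix (prefix d) (suc B) + prefix (unit (suc i)) (suc B)         ≡⟨ prefix-+ (prefix d) (unit (suc i)) (suc B) ⟨
  prefix (λ m → prefix d m + unit (suc i) m) (suc B)                ≡⟨ prefix-cong (prefix-rightFiring firing) (suc B) ⟩
  potential B c                                                     ∎
  where open ≡-Reasoning

fire-potential : ∀ {B c d} → Admissible c → Bounded B c → Fire c d → + 1 + potential B d ≡ potential B c
fire-potential adm bounded fire with fire-rightward (adm .decreasing) fire
... | _ , firing = potential-rightFiring firing (fireable-< adm bounded (firing .fireable))

accessible : ∀ B {c} → Admissible c → Bounded B c → Acc (flip Fire) c
accessible B {c} adm bounded = below ℤ.∣ potential B c ∣ adm bounded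
  (ℤₚ.≤-reflexive (sym (ℤₚ.0≤i⇒+∣i∣≡i (potential-nonNegative B (adm .nonNegative)))))
  where
  below : ∀ k {c} → Admissible c → Bounded B c → potential B c ≤ + k → Acc (flip Fire) c
  below k adm bounded Φ≤k = acc λ fire →
    after k (fire-admissible adm fire) (≼-bounded (fire-≼ adm fire) bounded)
      (ℤₚ.≤-trans (ℤₚ.≤-reflexive (fire-potential adm bounded fire)) Φ≤k)
    where
    after : ∀ k {d} → Admissible d → Bounded B d → + 1 + potential B d ≤ + k → Acc (flip Fire) d
    after zero adm′ _ 1+Φ′≤0
      with ℤₚ.≤-trans (ℤₚ.i≤i+j (+ 1) _ {{ℤ.nonNegative (potential-nonNegative B (adm′ .nonNegative))}}) 1+Φ′≤0
    ... | +≤+ ()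
    after (suc k) adm′ bounded′ 1+Φ′≤1+k = below k adm′ bounded′ (+-cancelˡ-≤ (+ 1) 1+Φ′≤1+k)

normalForm : ∀ B {c} → Admissible c → Bounded B c → Acc (flip Fire) c →
             Σ Config λ t → Star Fire c t × Stable t
normalForm B {c} adm bounded (acc next) with ℕₚ.anyUpTo? (λ i → + 2 ℤₚ.≤? c i - c (suc i)) B
... | yes (i , _ , fire) =
  let firing : RightFiring c i (moveFlow c i (suc i))
      firing = rightFiring fire (λ _ → refl)
      t , steps , stable = normalForm B (rightFiring-admissible firing adm)
        (≼-bounded (rightFiring-≼ firing) bounded) (next (rightFiring⇒fire firing))
  in t , rightFiring⇒fire firing ◅ steps , stable
... | no none =
  c , ε , rightStable⇒stable (adm .decreasing) λ i fire → none (i , fireable-< adm bounded fire , fire)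

-- The initial configuration

initial-< : ∀ f {n k} → k ℕ.< n → initial f n k ≡ + f
initial-< f k<n rewrite <⇒<ᵇ-true k<n = refl

initial-≥ : ∀ f {n k} → n ℕ.≤ k → initial f n k ≡ 0ℤ
initial-≥ f n≤k rewrite ≥⇒<ᵇ-false n≤k = refl

initial-admissible : ∀ f n → Admissible (initial f n)
initial-admissible f n = record { decreasing = decreasing′ ; nonNegative = nonNegative′ }
  where
  nonNegative′ : NonNegative (initial f n)
  nonNegative′ k with k <ᵇ n
  ... | true  = +≤+ z≤n
  ... | false = +≤+ z≤n
  decreasing′ : Decreasing (initial f n)
  decreasing′ k with suc k ℕ.<? n
  ... | yes 1+k<n =
    ℤₚ.≤-reflexive (trans (initial-< f 1+k<n) (sym (initial-< f (ℕₚ.<-trans (ℕₚ.n<1+n k) 1+k<n))))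
  ... | no 1+k≮n = subst (_≤ initial f n k) (sym (initial-≥ f (ℕₚ.≮⇒≥ 1+k≮n))) (nonNegative′ k)

prefix-initial-≤ : ∀ f {n m} → m ℕ.≤ n → prefix (initial f n) m ≡ + (m * f)
prefix-initial-≤ f {m = zero} _ = refl
prefix-initial-≤ f {n} {suc m} m<n = begin
  prefix (initial f n) m + initial f n m   ≡⟨ cong₂ _+_ (prefix-initial-≤ f (ℕₚ.<⇒≤ m<n)) (initial-< f m<n) ⟩
  + (m * f) + + f                          ≡⟨ cong +_ (ℕₚ.+-comm (m * f) f) ⟩
  + (suc m * f)                            ∎
  where open ≡-Reasoning

prefix-initial-≥ : ∀ f {n m} → n ℕ.≤ m → prefix (initial f n) m ≡ prefix (initial f n) n
prefix-initial-≥ f {n} n≤m = go (ℕₚ.≤⇒≤′ n≤m)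
  where
  go : ∀ {m} → n ℕ.≤′ m → prefix (initial f n) m ≡ prefix (initial f n) n
  go ℕ.≤′-refl              = refl
  go (ℕ.≤′-step {m} n≤′m) = begin
    prefix (initial f n) m + initial f n m   ≡⟨ cong (_+_ (prefix (initial f n) m)) (initial-≥ f (ℕₚ.≤′⇒≤ n≤′m)) ⟩
    prefix (initial f n) m + 0ℤ              ≡⟨ ℤₚ.+-identityʳ (prefix (initial f n) m) ⟩
    prefix (initial f n) m                   ≡⟨ go n≤′m ⟩
    prefix (initial f n) n                   ∎
    where open ≡-Reasoning

initial-bounded : ∀ f n → Bounded (n * f) (initial f n)
initial-bounded f n m with m ℕ.≤? n
... | yes m≤n = ℤₚ.≤-trans (ℤₚ.≤-reflexive (prefix-initial-≤ f m≤n)) (+≤+ (ℕₚ.*-monoˡ-≤ f m≤n))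
... | no m≰n  =
  ℤₚ.≤-reflexive (trans (prefix-initial-≥ f (ℕₚ.<⇒≤ (ℕₚ.≰⇒> m≰n))) (prefix-initial-≤ f {n} ℕₚ.≤-refl))

initial-terminating : ∀ f n → Acc (flip Fire) (initial f n)
initial-terminating f n = accessible (n * f) (initial-admissible f n) (initial-bounded f n)

≼-initial⇒≤ : ∀ f n {t} → Admissible t → t ≼ initial f n → 0 ℕ.< n → ∀ r → t r ≤ + f
≼-initial⇒≤ f n {t} adm t≼initial 0<n r = begin
  t r                        ≤⟨ decreasing-≤ (adm .decreasing) z≤n ⟩
  t 0                        ≡⟨ ℤₚ.+-identityˡ (t 0) ⟨
  prefix t 1                 ≤⟨ t≼initial 1 ⟩
  prefix (initial f n) 1     ≡⟨ prefix-initial-≤ f 0<n ⟩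
  + (1 * f)                  ≡⟨ cong +_ (ℕₚ.*-identityˡ f) ⟩
  + f                        ∎
  where open ℤₚ.≤-Reasoning

-- Up to n the deficit t j < f shows; beyond n the flow at face k + 1 is missing from prefix t m.
prefix-<-initial : ∀ f n {t j k m} → Admissible t → t ≼ initial f n → t j ≢ + f → t (suc k) ≢ 0ℤ →
                   j ℕ.< m → m ℕ.≤ suc k → prefix t m < prefix (initial f n) m
prefix-<-initial f n {t} {j} {k} {m} adm t≼initial tj≢f t[1+k]≢0 j<m m≤1+k with m ℕ.≤? n
... | yes m≤n = prefix-mono-< m j<m t≤initial (subst (t j <_) (sym (initial-< f (ℕₚ.<-≤-trans j<m m≤n))) tj<f)
  where
  t≤f : ∀ r → t r ≤ + f
  t≤f = ≼-initial⇒≤ f n adm t≼initial (ℕₚ.<-≤-trans (ℕₚ.≤-<-trans z≤n j<m) m≤n)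
  t≤initial : ∀ r → r ℕ.< m → t r ≤ initial f n r
  t≤initial r r<m = subst (t r ≤_) (sym (initial-< f (ℕₚ.<-≤-trans r<m m≤n))) (t≤f r)
  tj<f : t j < + f
  tj<f = ℤₚ.≤∧≢⇒< (t≤f j) tj≢f
... | no m≰n = ℤₚ.suc[i]≤j⇒i<j (begin
  + 1 + prefix t m                     ≤⟨ ℤₚ.+-monoˡ-≤ (prefix t m) 1≤t[1+k] ⟩
  t (suc k) + prefix t m               ≡⟨ ℤₚ.+-comm (t (suc k)) (prefix t m) ⟩
  prefix t m + t (suc k)               ≤⟨ ℤₚ.+-monoˡ-≤ (t (suc k)) (prefix-monoʳ-≤ (adm .nonNegative) m≤1+k) ⟩
  prefix t (suc (suc k))               ≤⟨ t≼initial (suc (suc k)) ⟩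
  prefix (initial f n) (suc (suc k))   ≡⟨ prefix-initial-≥ f (ℕₚ.≤-trans n≤m (ℕₚ.m≤n⇒m≤1+n m≤1+k)) ⟩
  prefix (initial f n) n               ≡⟨ prefix-initial-≥ f n≤m ⟨
  prefix (initial f n) m               ∎)
  where
  open ℤₚ.≤-Reasoning
  n≤m : n ℕ.≤ m
  n≤m = ℕₚ.<⇒≤ (ℕₚ.≰⇒> m≰n)
  1≤t[1+k] : + 1 ≤ t (suc k)
  1≤t[1+k] = ℤₚ.i<j⇒suc[i]≤j (ℤₚ.≤∧≢⇒< (adm .nonNegative (suc k)) (t[1+k]≢0 ∘ sym))

no-two-flat-pairs : ∀ f n {t j k} → Star Fire (initial f n) t → Stable t → j ℕ.< k →
                    ¬ Disregarded f t j → t j ≡ t (suc j) → ¬ Disregarded f t k → t k ≡ t (suc k) → ⊥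
no-two-flat-pairs f n {t} {j} {k} steps stable j<k kept-j flat-j kept-k flat-k =
  ℤₚ.<⇒≱ t<s (s≼t (suc j))
  where
  adm : Admissible t
  adm = reachable-admissible (initial-admissible f n) steps
  t≼initial : t ≼ initial f n
  t≼initial = reachable-≼ (initial-admissible f n) steps
  tj≢f : t j ≢ + f
  tj≢f tj≡f = kept-j (inj₁ (tj≡f , trans (sym flat-j) tj≡f))
  t[1+k]≢0 : t (suc k) ≢ 0ℤ
  t[1+k]≢0 t[1+k]≡0 = kept-k (inj₂ (trans flat-k t[1+k]≡0 , t[1+k]≡0))
  s : Config
  s = moveFlow t (suc k) j
  s≼initial : s ≼ initial f n
  s≼initial = leftMove-≼ (ℕₚ.m<n⇒m<1+n j<k) t≼initial
    (λ _ → prefix-<-initial f n adm t≼initial tj≢f t[1+k]≢0)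
  s≼t : s ≼ t
  s≼t = ≼-reachable (leftMove-rightStable (stable⇒rightStable {t} stable) j<k flat-j flat-k)
    s≼initial (initial-admissible f n) steps
  t<s : prefix t (suc j) < prefix s (suc j)
  t<s = subst (prefix t (suc j) <_) (sym (prefix-leftMove-inside (ℕₚ.n<1+n j) (ℕₚ.m<n⇒m<1+n j<k)))
    (ℤₚ.suc[i]≤j⇒i<j (ℤₚ.≤-reflexive (ℤₚ.+-comm (+ 1) (prefix t (suc j)))))

rightStable-steps : ∀ {t} → Decreasing t → RightStable t → ∀ k → t k ≡ t (suc k) ⊎ t k ≡ t (suc k) + + 1
rightStable-steps {t} dec t-stable k with t k ℤₚ.≟ t (suc k)
... | yes flat = inj₁ flat
... | no  t[k]≢t[1+k] = inj₂ (ℤₚ.≤-antisym upper lower)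
  where
  upper : t k ≤ t (suc k) + + 1
  upper = minus-≤⇒≤-+ (ℤₚ.i<j⇒i≤pred[j] (ℤₚ.≰⇒> (t-stable k)))
  lower : t (suc k) + + 1 ≤ t k
  lower = <⇒+1≤ (ℤₚ.≤∧≢⇒< (dec k) (t[k]≢t[1+k] ∘ sym))

stable-shape : ∀ f n {t} → Star Fire (initial f n) t → Stable t → Shape f t
stable-shape f n {t} steps stable = dec , (λ k → inj₂ (rightStable-steps dec (stable⇒rightStable {t} stable) k)) , flat-unique
  where
  dec : Decreasing t
  dec = reachable-admissible (initial-admissible f n) steps .decreasing
  flat-unique : ∀ j k → ¬ Disregarded f t j → t j ≡ t (suc j) → ¬ Disregarded f t k → t k ≡ t (suc k) → j ≡ k
  flat-unique j k kept-j flat-j kept-k flat-k with ℕₚ.<-cmp j k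
  ... | tri< j<k _ _ = ⊥-elim (no-two-flat-pairs f n steps stable j<k kept-j flat-j kept-k flat-k)
  ... | tri≈ _ j≡k _ = j≡k
  ... | tri> _ _ k<j = ⊥-elim (no-two-flat-pairs f n steps stable k<j kept-k flat-k kept-j flat-j)

mainTheorem2 : (f n : ℕ) →
    Acc (flip Fire) (initial f n)
    × Σ Config (λ s →
        Star Fire (initial f n) s
        × Stable s
        × (∀ t → Star Fire (initial f n) t → Stable t → ∀ k → t k ≡ s k)
        × Shape f s)
mainTheorem2 f n with normalForm (n * f) (initial-admissible f n) (initial-bounded f n) (initial-terminating f n)
... | s , steps , stable =
    initial-terminating f n
  , s , steps , stable
  , (λ _ steps′ stable′ → stable-unique (initial-admissible f n) steps′ stable′ steps stable)
  , stable-shape f n steps stable
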